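{- Let $G=(V,E)$ be a finite graph and let $v\in V$ be a simplicial vertex of $G$ (i.e. $N_G[v]=\{v\}\cup N_G(v)$ is a clique). Then for every integer $n\geq 2$, $$C(I_n(G))\leq \max\{C(I_n(G\setminus v)),\ C(I_{n-1}(G[V\setminus N_G[v]]))+1\}.$$
   Context: Graphs are finite, simple and undirected; $N_G(v)$ is the set of neighbours of $v$, $G\setminus v=G[V\setminus\{v\}]$, and $G[U]$ is the induced subgraph. For an integer $n\geq 1$, $I_n(G)=\{U\subseteq V:\ \alpha(G[U])<n\}$, where $\alpha$ is the independence number. For a finite simplicial complex $X$, a face $\sigma$ contained in a unique maximal face $\tau$ is a free face; if $|\sigma|\leq d$, removing all faces $\eta$ with $\sigma\subseteq\eta\subseteq\tau$ is an elementary $d$-collapse. $X$ is $d$-collapsible if a sequence of elementary $d$-collapses reduces it to the void complex (no faces at all). $C(X)$ is the minimum $d$ such that $X$ is $d$-collapsible. -}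

module Defs where

open import Level using (0ℓ)
open import Data.Nat using (ℕ; _<_; _≤_; suc)
open import Data.Fin using (Fin)
open import Data.Unit using (⊤)
open import Data.Fin.Subset using (Subset; _∈_; _⊆_; ∣_∣)
open import Data.Product using (_×_; Σ)
open import Data.Sum using (_⊎_)
open import Relation.Nullary using (¬_)
open import Relation.Unary using (Pred)
open import Relation.Binary.PropositionalEquality using (_≡_; _≢_)

record Graph (m : ℕ) : Set₁ where
  field
    Adj   : Fin m → Fin m → Set
    sym   : ∀ {i j} → Adj i j → Adj j i
    irrefl : ∀ {i} → ¬ Adj i i
open Graph public

ClosedNbhd : ∀ {m} → Graph m → Fin m → Pred (Fin m) 0ℓ
ClosedNbhd G v i = i ≡ v ⊎ Adj G v i

Simplicial : ∀ {m} → Graph m → Fin m → Set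
Simplicial G v = ∀ i j → ClosedNbhd G v i → ClosedNbhd G v j → i ≢ j → Adj G i j

Independent : ∀ {m} → Graph m → Subset m → Set
Independent G S = ∀ i j → i ∈ S → j ∈ S → ¬ Adj G i j

Complex : ℕ → Set₁
Complex m = Pred (Subset m) 0ℓ

-- I_n(G[W]) viewed as a complex on the ambient vertex set Fin m:
-- faces are U ⊆ W with α(G[U]) < n, i.e. every independent subset of U has size < n.
InSet : ∀ {m} → Pred (Fin m) 0ℓ → Subset m → Set
InSet W U = ∀ i → i ∈ U → W i

Ind : ∀ {m} → ℕ → Graph m → Pred (Fin m) 0ℓ → Complex m
Ind n G W U = InSet W U × (∀ S → S ⊆ U → Independent G S → ∣ S ∣ < n)

Everything : ∀ {m} → Pred (Fin m) 0ℓ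
Everything i = ⊤

MaximalFace : ∀ {m} → Complex m → Subset m → Set
MaximalFace X τ = X τ × (∀ η → X η → τ ⊆ η → τ ≡ η)

FreeFace : ∀ {m} → Complex m → Subset m → Subset m → Set
FreeFace X σ τ = X σ × MaximalFace X τ × σ ⊆ τ ×
                 (∀ τ′ → MaximalFace X τ′ → σ ⊆ τ′ → τ′ ≡ τ)

ElemCollapse : ∀ {m} → ℕ → Complex m → Complex m → Set
ElemCollapse d X Y = Σ _ λ σ → Σ _ λ τ → FreeFace X σ τ × ∣ σ ∣ ≤ d ×
  (∀ η → (Y η → X η × ¬ (σ ⊆ η × η ⊆ τ)) × (X η × ¬ (σ ⊆ η × η ⊆ τ) → Y η))

Void : ∀ {m} → Complex m → Set
Void X = ∀ η → ¬ X η

data Collapsible {m : ℕ} (d : ℕ) : Complex m → Set₁ where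
  done : ∀ {X} → Void X → Collapsible d X
  step : ∀ {X Y} → ElemCollapse d X Y → Collapsible d Y → Collapsible d X

IsCollapsibility : ∀ {m} → Complex m → ℕ → Set₁
IsCollapsibility X c = Collapsible c X × (∀ d → Collapsible d X → c ≤ d)

-- Write M = V ∖ N[v] and X = I_n(G). A face of X avoiding v is a face of D = I_n(G ∖ v); a
-- face η through v is a face of X exactly when η ∩ M is a face of K = I_(n-1)(G[M]): an
-- independent set meets the clique N[v] in at most one vertex, and v can be added to any
-- independent subset of M. So X is D glued to K along v, and each elementary c₂-collapse
-- (σ, τ) of K lifts to the elementary (c₂+1)-collapse (σ ∪ {v}, τ ∪ N[v]) of X. Performing
-- all of them removes every face through v and leaves D, which then collapses on its own.

module Submission where

open import Defs hiding (sym)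
open import Data.Nat using (ℕ; zero; suc; _≤_; _<_; _+_; _⊔_; _∸_; z≤n; s≤s)
open import Data.Nat.Properties
  using (≤-trans; ≤-reflexive; ≤-pred; <⇒≱; +-suc; +-comm; +-monoʳ-≤; +-mono-≤; n≤1+n; m≤m⊔n; m≤n⊔m)
open import Data.Fin using (Fin) renaming (_≟_ to _≟ᶠ_)
open import Data.Fin.Properties using (any?)
open import Data.Fin.Subset using (Subset; _∈_; _∉_; _⊆_; _⊃_; ∣_∣; _∪_; _∩_; ∁; ⁅_⁆)
open import Data.Fin.Subset.Properties
  using ( _∈?_; _⊆?_; ⊆-refl; ⊆-trans; ⊆-antisym; p⊆q⇒∣p∣≤∣q∣; p⊂q⇒∣p∣<∣q∣; ∣⁅x⁆∣≡1; x≢y⇒x∉⁅y⁆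
        ; x∈⁅x⁆; x∈⁅y⁆⇒x≡y; nonempty?; Empty-unique; ∣⊥∣≡0; p⊆p∪q; p∩q⊆p; p∩q⊆q
        ; x∈p∪q⁺; x∈p∪q⁻; x∈p∩q⁺; x∈p∩q⁻; x∉p⇒x∈∁p; x∈∁p⇒x∉p )
open import Data.Fin.Subset.Induction using (Acc; acc; ⊃-wellFounded)
open import Data.Product using (∃; _×_; _,_; proj₁; proj₂)
open import Data.Product.Function.NonDependent.Propositional using (_×-⇔_)
open import Data.Sum using (_⊎_; inj₁; inj₂)
open import Data.Empty using (⊥-elim)
open import Data.Bool using (true; false)
open import Data.Vec using ([]; _∷_; tabulate)
open import Data.Vec.Properties using (lookup∘tabulate; lookup⇒[]=; []=⇒lookup)
open import Data.Unit using (tt)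
open import Function using (_∘_)
open import Function.Bundles using (_⇔_; mk⇔; Equivalence)
open import Relation.Nullary using (¬_; yes; no; ¬?; does)
open import Relation.Nullary.Decidable using (_×-dec_; decidable-stable; map′; dec-true)
open import Relation.Unary using (Decidable; _≐_)
open import Relation.Binary.PropositionalEquality
  using (_≡_; _≢_; refl; sym; trans; subst; cong)

private
  variable
    m c d : ℕ

∣p∪q∣≤∣p∣+∣q∣ : ∀ (p q : Subset m) → ∣ p ∪ q ∣ ≤ ∣ p ∣ + ∣ q ∣
∣p∪q∣≤∣p∣+∣q∣ [] [] = z≤n
∣p∪q∣≤∣p∣+∣q∣ (false ∷ p) (false ∷ q) = ∣p∪q∣≤∣p∣+∣q∣ p q
∣p∪q∣≤∣p∣+∣q∣ (true ∷ p) (false ∷ q) = s≤s (∣p∪q∣≤∣p∣+∣q∣ p q)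
∣p∪q∣≤∣p∣+∣q∣ (false ∷ p) (true ∷ q) rewrite +-suc ∣ p ∣ ∣ q ∣ = s≤s (∣p∪q∣≤∣p∣+∣q∣ p q)
∣p∪q∣≤∣p∣+∣q∣ (true ∷ p) (true ∷ q) =
  s≤s (≤-trans (∣p∪q∣≤∣p∣+∣q∣ p q) (+-monoʳ-≤ ∣ p ∣ (n≤1+n ∣ q ∣)))

∣p∪⁅x⁆∣≤1+∣p∣ : ∀ (p : Subset m) x → ∣ p ∪ ⁅ x ⁆ ∣ ≤ suc ∣ p ∣
∣p∪⁅x⁆∣≤1+∣p∣ p x = ≤-trans (∣p∪q∣≤∣p∣+∣q∣ p ⁅ x ⁆)
  (≤-reflexive (trans (cong (∣ p ∣ +_) (∣⁅x⁆∣≡1 x)) (+-comm ∣ p ∣ 1)))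

x∉p⇒∣p∣<∣p∪⁅x⁆∣ : ∀ {p : Subset m} {x} → x ∉ p → ∣ p ∣ < ∣ p ∪ ⁅ x ⁆ ∣
x∉p⇒∣p∣<∣p∪⁅x⁆∣ {x = x} x∉p = p⊂q⇒∣p∣<∣q∣ (p⊆p∪q ⁅ x ⁆ , x , x∈p∪q⁺ (inj₂ (x∈⁅x⁆ x)) , x∉p)

subsingleton⇒∣p∣≤1 : ∀ (p : Subset m) → (∀ {x y} → x ∈ p → y ∈ p → x ≡ y) → ∣ p ∣ ≤ 1
subsingleton⇒∣p∣≤1 {m} p unique with nonempty? p
... | yes (x , x∈p) = ≤-trans (p⊆q⇒∣p∣≤∣q∣ p⊆⁅x⁆) (≤-reflexive (∣⁅x⁆∣≡1 x))
  where
  p⊆⁅x⁆ : p ⊆ ⁅ x ⁆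
  p⊆⁅x⁆ y∈p = subst (_∈ ⁅ x ⁆) (unique x∈p y∈p) (x∈⁅x⁆ x)
... | no empty = ≤-trans (≤-reflexive (trans (cong ∣_∣ (Empty-unique empty)) (∣⊥∣≡0 m))) z≤n

[p∪q]∩r≡p : ∀ {p q r : Subset m} → p ⊆ r → (∀ {x} → x ∈ q → x ∉ r) → (p ∪ q) ∩ r ≡ p
[p∪q]∩r≡p {p = p} {q} {r} p⊆r q∩r=∅ = ⊆-antisym ⊆p p⊆
  where
  ⊆p : (p ∪ q) ∩ r ⊆ p
  ⊆p x∈ with x∈p∩q⁻ (p ∪ q) r x∈
  ... | x∈p∪q , x∈r with x∈p∪q⁻ p q x∈p∪q
  ...   | inj₁ x∈p = x∈p
  ...   | inj₂ x∈q = ⊥-elim (q∩r=∅ x∈q x∈r)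
  p⊆ : p ⊆ (p ∪ q) ∩ r
  p⊆ x∈p = x∈p∩q⁺ (x∈p∪q⁺ (inj₁ x∈p) , p⊆r x∈p)

p∪⁅x⁆⊆q⇔p⊆q∩r : ∀ {p q r : Subset m} {x} → p ⊆ r → x ∈ q → p ∪ ⁅ x ⁆ ⊆ q ⇔ p ⊆ q ∩ r
p∪⁅x⁆⊆q⇔p⊆q∩r {p = p} {q} {r} {x} p⊆r x∈q = mk⇔ to from
  where
  to : p ∪ ⁅ x ⁆ ⊆ q → p ⊆ q ∩ r
  to p∪⁅x⁆⊆q y∈p = x∈p∩q⁺ (p∪⁅x⁆⊆q (x∈p∪q⁺ (inj₁ y∈p)) , p⊆r y∈p)
  from : p ⊆ q ∩ r → p ∪ ⁅ x ⁆ ⊆ q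
  from p⊆q∩r y∈ with x∈p∪q⁻ p ⁅ x ⁆ y∈
  ... | inj₁ y∈p = p∩q⊆p q r (p⊆q∩r y∈p)
  ... | inj₂ y∈⁅x⁆ = subst (_∈ q) (sym (x∈⁅y⁆⇒x≡y x y∈⁅x⁆)) x∈q

p⊆q∪∁r⇔p∩r⊆q : ∀ {p q r : Subset m} → p ⊆ q ∪ ∁ r ⇔ p ∩ r ⊆ q
p⊆q∪∁r⇔p∩r⊆q {p = p} {q} {r} = mk⇔ to from
  where
  to : p ⊆ q ∪ ∁ r → p ∩ r ⊆ q
  to p⊆ x∈ with x∈p∩q⁻ p r x∈
  ... | x∈p , x∈r with x∈p∪q⁻ q (∁ r) (p⊆ x∈p)
  ...   | inj₁ x∈q = x∈q
  ...   | inj₂ x∈∁r = ⊥-elim (x∈∁p⇒x∉p x∈∁r x∈r)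
  from : p ∩ r ⊆ q → p ⊆ q ∪ ∁ r
  from p∩r⊆q {x} x∈p with x ∈? r
  ... | yes x∈r = x∈p∪q⁺ (inj₁ (p∩r⊆q (x∈p∩q⁺ (x∈p , x∈r))))
  ... | no x∉r = x∈p∪q⁺ (inj₂ (x∉p⇒x∈∁p x∉r))

x∈⁅y⁆∪⁅z⁆⇒ : ∀ {x y z : Fin m} → x ∈ ⁅ y ⁆ ∪ ⁅ z ⁆ → x ≡ y ⊎ x ≡ z
x∈⁅y⁆∪⁅z⁆⇒ {y = y} {z} x∈ with x∈p∪q⁻ ⁅ y ⁆ ⁅ z ⁆ x∈
... | inj₁ x∈⁅y⁆ = inj₁ (x∈⁅y⁆⇒x≡y y x∈⁅y⁆)
... | inj₂ x∈⁅z⁆ = inj₂ (x∈⁅y⁆⇒x≡y z x∈⁅z⁆)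

p⊆[p∩q]∪[p∩∁q] : ∀ (p q : Subset m) → p ⊆ (p ∩ q) ∪ (p ∩ ∁ q)
p⊆[p∩q]∪[p∩∁q] p q {x} x∈p with x ∈? q
... | yes x∈q = x∈p∪q⁺ (inj₁ (x∈p∩q⁺ (x∈p , x∈q)))
... | no x∉q = x∈p∪q⁺ (inj₂ (x∈p∩q⁺ (x∈p , x∉p⇒x∈∁p x∉q)))

toSubset : ∀ {P : Fin m → Set} → Decidable P → Subset m
toSubset P? = tabulate (λ i → does (P? i))

x∈toSubset⇔ : ∀ {P : Fin m → Set} (P? : Decidable P) {x} → x ∈ toSubset P? ⇔ P x
x∈toSubset⇔ {P = P} P? {x} = mk⇔ from
  (λ Px → lookup⇒[]= x _ (trans (lookup∘tabulate _ x) (dec-true (P? x) Px)))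
  where
  from : x ∈ toSubset P? → P x
  from x∈ with P? x | trans (sym (lookup∘tabulate (λ i → does (P? i)) x)) ([]=⇒lookup x∈)
  ... | yes Px | _ = Px

DownClosed : Complex m → Set
DownClosed X = ∀ {ρ η} → ρ ⊆ η → X η → X ρ

SupportedOn : Subset m → Complex m → Set
SupportedOn M X = ∀ {η} → X η → η ⊆ M

Collapsible-resp-≐ : ∀ {X Y : Complex m} → X ≐ Y → Collapsible d X → Collapsible d Y
Collapsible-resp-≐ (_ , Y⊆X) (done void) = done (λ η Yη → void η (Y⊆X Yη))
Collapsible-resp-≐ {Y = Y} (X⊆Y , Y⊆X)
  (step {Y = X′} (σ , τ , (Xσ , (Xτ , τ-max) , σ⊆τ , τ-unique) , ∣σ∣≤d , X′-spec) rest) =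
  step (σ , τ , free , ∣σ∣≤d , spec) rest
  where
  free : FreeFace Y σ τ
  free = X⊆Y Xσ , (X⊆Y Xτ , λ η Yη → τ-max η (Y⊆X Yη)) , σ⊆τ ,
         λ τ′ (Yτ′ , τ′-max) → τ-unique τ′ (Y⊆X Yτ′ , λ η Xη → τ′-max η (X⊆Y Xη))
  spec : ∀ η → (X′ η → Y η × ¬ (σ ⊆ η × η ⊆ τ)) × (Y η × ¬ (σ ⊆ η × η ⊆ τ) → X′ η)
  spec η = (λ X′η → let (Xη , ∉I) = proj₁ (X′-spec η) X′η in X⊆Y Xη , ∉I)
         , (λ (Yη , ∉I) → proj₂ (X′-spec η) (Y⊆X Yη , ∉I))

Collapsible-mono : ∀ {d′} {X : Complex m} → d ≤ d′ → Collapsible d X → Collapsible d′ X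
Collapsible-mono d≤d′ (done void) = done void
Collapsible-mono d≤d′ (step (σ , τ , free , ∣σ∣≤d , spec) rest) =
  step (σ , τ , free , ≤-trans ∣σ∣≤d d≤d′ , spec) (Collapsible-mono d≤d′ rest)

under-face-or-absent : ∀ {X : Complex m} → Collapsible d X → ∀ ρ →
                       (∃ λ τ → X τ × ρ ⊆ τ) ⊎ ¬ X ρ
under-face-or-absent (done void) ρ = inj₂ (void ρ)
under-face-or-absent (step (σ , τ , (_ , (Xτ , _) , _) , _ , spec) rest) ρ with ρ ⊆? τ
... | yes ρ⊆τ = inj₁ (τ , Xτ , ρ⊆τ)
... | no ρ⊈τ with under-face-or-absent rest ρ
...   | inj₁ (τ′ , Yτ′ , ρ⊆τ′) = inj₁ (τ′ , proj₁ (proj₁ (spec τ′) Yτ′) , ρ⊆τ′)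
...   | inj₂ ¬Yρ = inj₂ (λ Xρ → ¬Yρ (proj₂ (spec ρ) (Xρ , λ (_ , ρ⊆τ) → ρ⊈τ ρ⊆τ)))

collapsible⇒decidable : ∀ {X : Complex m} → DownClosed X → Collapsible d X → Decidable X
collapsible⇒decidable down col ρ with under-face-or-absent col ρ
... | inj₁ (τ , Xτ , ρ⊆τ) = yes (down ρ⊆τ Xτ)
... | inj₂ ¬Xρ = no ¬Xρ

maximal-face-above : ∀ (X : Complex m) {ρ} → X ρ → ¬ ¬ (∃ λ τ → MaximalFace X τ × ρ ⊆ τ)
maximal-face-above X = go (⊃-wellFounded _)
  where
  go : ∀ {ρ} → Acc _⊃_ ρ → X ρ → ¬ ¬ (∃ λ τ → MaximalFace X τ × ρ ⊆ τ)
  go {ρ} (acc larger) Xρ none-above = none-above (ρ , (Xρ , ρ-max) , ⊆-refl)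
    where
    ρ-max : ∀ η → X η → ρ ⊆ η → ρ ≡ η
    ρ-max η Xη ρ⊆η with any? (λ x → x ∈? η ×-dec ¬? (x ∈? ρ))
    ... | yes new = ⊥-elim (go (larger (ρ⊆η , new)) Xη
                      λ (τ , τ-max , η⊆τ) → none-above (τ , τ-max , ⊆-trans ρ⊆η η⊆τ))
    ... | no no-new = ⊆-antisym ρ⊆η λ {x} x∈η →
                        decidable-stable (x ∈? ρ) λ x∉ρ → no-new (x , x∈η , x∉ρ)

freeFace-coface⊆ : ∀ {X : Complex m} {σ τ ρ} → FreeFace X σ τ → X ρ → σ ⊆ ρ → ρ ⊆ τ
freeFace-coface⊆ {X = X} {τ = τ} {ρ} (_ , _ , _ , τ-unique) Xρ σ⊆ρ with ρ ⊆? τ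
... | yes ρ⊆τ = ρ⊆τ
... | no ρ⊈τ = ⊥-elim (maximal-face-above X Xρ λ (τ′ , τ′-max , ρ⊆τ′) →
                 ρ⊈τ (subst (ρ ⊆_) (τ-unique τ′ τ′-max (⊆-trans σ⊆ρ ρ⊆τ′)) ρ⊆τ′))

module Gluing {v : Fin m} {M : Subset m} (v∉M : v ∉ M)
              (D : Complex m) (D-avoids-v : ∀ {η} → D η → v ∉ η) where

  Glue : Complex m → Complex m
  Glue K η = D η ⊎ (v ∈ η × K (η ∩ M))

  private
    v∈σ∪⁅v⁆ : ∀ {σ} → v ∈ σ ∪ ⁅ v ⁆
    v∈σ∪⁅v⁆ = x∈p∪q⁺ (inj₂ (x∈⁅x⁆ v))

    v∈τ∪∁M : ∀ {τ} → v ∈ τ ∪ ∁ M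
    v∈τ∪∁M = x∈p∪q⁺ (inj₂ (x∉p⇒x∈∁p v∉M))

    [σ∪⁅v⁆]∩M≡σ : ∀ {σ} → σ ⊆ M → (σ ∪ ⁅ v ⁆) ∩ M ≡ σ
    [σ∪⁅v⁆]∩M≡σ σ⊆M = [p∪q]∩r≡p σ⊆M λ x∈⁅v⁆ → subst (_∉ M) (sym (x∈⁅y⁆⇒x≡y v x∈⁅v⁆)) v∉M

    [τ∪∁M]∩M≡τ : ∀ {τ} → τ ⊆ M → (τ ∪ ∁ M) ∩ M ≡ τ
    [τ∪∁M]∩M≡τ τ⊆M = [p∪q]∩r≡p τ⊆M x∈∁p⇒x∉p

  Glue-void : ∀ {K} → Void K → D ≐ Glue K
  Glue-void K-void = inj₁ , λ { (inj₁ Dη) → Dη ; (inj₂ (_ , Kη)) → ⊥-elim (K-void _ Kη) }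

  lift-freeFace : ∀ {K σ τ} → SupportedOn M K → FreeFace K σ τ →
                  FreeFace (Glue K) (σ ∪ ⁅ v ⁆) (τ ∪ ∁ M)
  lift-freeFace {K} {σ} {τ} K⊆M free@(Kσ , (Kτ , τ-max) , σ⊆τ , τ-unique) =
    Glue-σ⁺ , (Glue-τ⁺ , τ⁺-max) , σ⁺⊆τ⁺ , τ⁺-unique
    where
    Glue-σ⁺ : Glue K (σ ∪ ⁅ v ⁆)
    Glue-σ⁺ = inj₂ (v∈σ∪⁅v⁆ , subst K (sym ([σ∪⁅v⁆]∩M≡σ (K⊆M Kσ))) Kσ)
    Glue-τ⁺ : Glue K (τ ∪ ∁ M)
    Glue-τ⁺ = inj₂ (v∈τ∪∁M , subst K (sym ([τ∪∁M]∩M≡τ (K⊆M Kτ))) Kτ)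
    σ⁺⊆τ⁺ : σ ∪ ⁅ v ⁆ ⊆ τ ∪ ∁ M
    σ⁺⊆τ⁺ = Equivalence.from (p∪⁅x⁆⊆q⇔p⊆q∩r (K⊆M Kσ) v∈τ∪∁M)
              (subst (σ ⊆_) (sym ([τ∪∁M]∩M≡τ (K⊆M Kτ))) σ⊆τ)
    τ⁺-max : ∀ η → Glue K η → τ ∪ ∁ M ⊆ η → τ ∪ ∁ M ≡ η
    τ⁺-max η (inj₁ Dη) τ⁺⊆η = ⊥-elim (D-avoids-v Dη (τ⁺⊆η v∈τ∪∁M))
    τ⁺-max η (inj₂ (_ , Kη∩M)) τ⁺⊆η = ⊆-antisym τ⁺⊆η (Equivalence.from p⊆q∪∁r⇔p∩r⊆q η∩M⊆τ)
      where
      τ⊆η∩M : τ ⊆ η ∩ M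
      τ⊆η∩M x∈τ = x∈p∩q⁺ (τ⁺⊆η (x∈p∪q⁺ (inj₁ x∈τ)) , K⊆M Kτ x∈τ)
      η∩M⊆τ : η ∩ M ⊆ τ
      η∩M⊆τ = subst (_⊆ τ) (τ-max (η ∩ M) Kη∩M τ⊆η∩M) ⊆-refl
    τ⁺-unique : ∀ τ′ → MaximalFace (Glue K) τ′ → σ ∪ ⁅ v ⁆ ⊆ τ′ → τ′ ≡ τ ∪ ∁ M
    τ⁺-unique τ′ (inj₁ Dτ′ , _) σ⁺⊆τ′ = ⊥-elim (D-avoids-v Dτ′ (σ⁺⊆τ′ v∈σ∪⁅v⁆))
    τ⁺-unique τ′ (inj₂ (v∈τ′ , Kτ′∩M) , τ′-max) σ⁺⊆τ′ =
      τ′-max (τ ∪ ∁ M) Glue-τ⁺ (Equivalence.from p⊆q∪∁r⇔p∩r⊆q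
        (freeFace-coface⊆ free Kτ′∩M (Equivalence.to (p∪⁅x⁆⊆q⇔p⊆q∩r (K⊆M Kσ) v∈τ′) σ⁺⊆τ′)))

  lift-elemCollapse : ∀ {K K′} → SupportedOn M K → suc c ≤ d →
                      ElemCollapse c K K′ → ElemCollapse d (Glue K) (Glue K′)
  lift-elemCollapse {d = d} {K} {K′} K⊆M c<d (σ , τ , free@(Kσ , _) , ∣σ∣≤c , K′-spec) =
    σ ∪ ⁅ v ⁆ , τ ∪ ∁ M , lift-freeFace K⊆M free , ∣σ⁺∣≤d , spec
    where
    ∣σ⁺∣≤d : ∣ σ ∪ ⁅ v ⁆ ∣ ≤ d
    ∣σ⁺∣≤d = ≤-trans (∣p∪⁅x⁆∣≤1+∣p∣ σ v) (≤-trans (s≤s ∣σ∣≤c) c<d)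
    interval : ∀ {η} → v ∈ η →
               (σ ∪ ⁅ v ⁆ ⊆ η × η ⊆ τ ∪ ∁ M) ⇔ (σ ⊆ η ∩ M × η ∩ M ⊆ τ)
    interval v∈η = p∪⁅x⁆⊆q⇔p⊆q∩r (K⊆M Kσ) v∈η ×-⇔ p⊆q∪∁r⇔p∩r⊆q
    spec : ∀ η → (Glue K′ η → Glue K η × ¬ (σ ∪ ⁅ v ⁆ ⊆ η × η ⊆ τ ∪ ∁ M))
               × (Glue K η × ¬ (σ ∪ ⁅ v ⁆ ⊆ η × η ⊆ τ ∪ ∁ M) → Glue K′ η)
    spec η = removed , kept
      where
      removed : Glue K′ η → Glue K η × ¬ (σ ∪ ⁅ v ⁆ ⊆ η × η ⊆ τ ∪ ∁ M)
      removed (inj₁ Dη) = inj₁ Dη , λ (σ⁺⊆η , _) → D-avoids-v Dη (σ⁺⊆η v∈σ∪⁅v⁆)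
      removed (inj₂ (v∈η , K′η∩M)) with proj₁ (K′-spec (η ∩ M)) K′η∩M
      ... | Kη∩M , ∉I = inj₂ (v∈η , Kη∩M) , λ I⁺ → ∉I (Equivalence.to (interval v∈η) I⁺)
      kept : Glue K η × ¬ (σ ∪ ⁅ v ⁆ ⊆ η × η ⊆ τ ∪ ∁ M) → Glue K′ η
      kept (inj₁ Dη , _) = inj₁ Dη
      kept (inj₂ (v∈η , Kη∩M) , ∉I⁺) =
        inj₂ (v∈η , proj₂ (K′-spec (η ∩ M)) (Kη∩M , λ I → ∉I⁺ (Equivalence.from (interval v∈η) I)))

  glue-collapsible : ∀ {K} → suc c ≤ d → Collapsible d D → SupportedOn M K →
                     Collapsible c K → Collapsible d (Glue K)
  glue-collapsible c<d D-col K⊆M (done K-void) =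
    Collapsible-resp-≐ (Glue-void K-void) D-col
  glue-collapsible c<d D-col K⊆M (step collapse@(_ , _ , _ , _ , K′-spec) rest) =
    step (lift-elemCollapse K⊆M c<d collapse)
         (glue-collapsible c<d D-col (λ K′η → K⊆M (proj₁ (proj₁ (K′-spec _) K′η))) rest)

Clique : Graph m → Subset m → Set
Clique G U = ∀ i j → i ∈ U → j ∈ U → i ≢ j → Adj G i j

Ind-downClosed : ∀ {n} {G : Graph m} {W} → DownClosed (Ind n G W)
Ind-downClosed ρ⊆η (η⊆W , small) = (λ i i∈ρ → η⊆W i (ρ⊆η i∈ρ)) , λ S S⊆ρ → small S (⊆-trans S⊆ρ ρ⊆η)

independent∧¬¬clique⇒∣S∣≤1 : ∀ {G : Graph m} {S} → Independent G S →
  (∀ {i j} → i ∈ S → j ∈ S → i ≢ j → ¬ ¬ Adj G i j) → ∣ S ∣ ≤ 1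
independent∧¬¬clique⇒∣S∣≤1 {S = S} independent adjacent = subsingleton⇒∣p∣≤1 S equal
  where
  equal : ∀ {i j} → i ∈ S → j ∈ S → i ≡ j
  equal {i} {j} i∈S j∈S =
    decidable-stable (i ≟ᶠ j) λ i≢j → adjacent i∈S j∈S i≢j (independent i j i∈S j∈S)

clique⇒Ind : ∀ {k} {G : Graph m} {W U} → Clique G U → InSet W U → Ind (suc (suc k)) G W U
clique⇒Ind {G = G} clique U⊆W =
  U⊆W , λ S S⊆U independent → s≤s (≤-trans (independent∧¬¬clique⇒∣S∣≤1 {G = G} independent
          λ i∈S j∈S i≢j ¬adj → ¬adj (clique _ _ (S⊆U i∈S) (S⊆U j∈S) i≢j)) (s≤s z≤n))

Clique-⁅x⁆ : ∀ {G : Graph m} x → Clique G ⁅ x ⁆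
Clique-⁅x⁆ x i j i∈ j∈ i≢j = ⊥-elim (i≢j (trans (x∈⁅y⁆⇒x≡y x i∈) (sym (x∈⁅y⁆⇒x≡y x j∈))))

Independent-⁅x⁆ : ∀ {G : Graph m} x → Independent G ⁅ x ⁆
Independent-⁅x⁆ {G = G} x i j i∈ j∈ rewrite x∈⁅y⁆⇒x≡y x i∈ | x∈⁅y⁆⇒x≡y x j∈ = irrefl G

Independent-⊆ : ∀ {G : Graph m} {S T} → S ⊆ T → Independent G T → Independent G S
Independent-⊆ S⊆T independent i j i∈S j∈S = independent i j (S⊆T i∈S) (S⊆T j∈S)

Independent-∪⁅x⁆ : ∀ {G : Graph m} {S x} → Independent G S → (∀ {i} → i ∈ S → ¬ Adj G x i) →
                   Independent G (S ∪ ⁅ x ⁆)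
Independent-∪⁅x⁆ {G = G} {S} {x} independent x-isolated i j i∈ j∈
  with x∈p∪q⁻ S ⁅ x ⁆ i∈ | x∈p∪q⁻ S ⁅ x ⁆ j∈
... | inj₁ i∈S | inj₁ j∈S = independent i j i∈S j∈S
... | inj₁ i∈S | inj₂ j∈⁅x⁆ rewrite x∈⁅y⁆⇒x≡y x j∈⁅x⁆ = x-isolated i∈S ∘ Graph.sym G
... | inj₂ i∈⁅x⁆ | inj₁ j∈S rewrite x∈⁅y⁆⇒x≡y x i∈⁅x⁆ = x-isolated j∈S
... | inj₂ i∈⁅x⁆ | inj₂ j∈⁅x⁆ rewrite x∈⁅y⁆⇒x≡y x i∈⁅x⁆ | x∈⁅y⁆⇒x≡y x j∈⁅x⁆ = irrefl G

module SimplicialVertex {G : Graph m} {v : Fin m} (simplicial : Simplicial G v) where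

  NonNeighbour : Fin m → Set
  NonNeighbour i = ¬ ClosedNbhd G v i

  Clique-⊆N[v] : ∀ {U : Subset m} → (∀ {i} → i ∈ U → ClosedNbhd G v i) → Clique G U
  Clique-⊆N[v] U⊆N[v] i j i∈U j∈U = simplicial i j (U⊆N[v] i∈U) (U⊆N[v] j∈U)

  -- Adjacency is not assumed decidable, so M is read off the given collapses: for n = 2 by
  -- asking whether {i, v} is a face of I_2(G), for n > 2 whether {i} is a face of K.
  nonNeighbour? : ∀ k → Collapsible c (Ind (2 + k) G Everything) →
                  Collapsible d (Ind (suc k) G NonNeighbour) → Decidable NonNeighbour
  nonNeighbour? zero X-col _ i with i ≟ᶠ v
  ... | yes refl = no (λ v∉N[v] → v∉N[v] (inj₁ refl))
  ... | no i≢v = map′ non-face⇒nonNeighbour nonNeighbour⇒non-face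
                   (¬? (collapsible⇒decidable (Ind-downClosed {G = G}) X-col (⁅ i ⁆ ∪ ⁅ v ⁆)))
    where
    non-face⇒nonNeighbour : ¬ Ind 2 G Everything (⁅ i ⁆ ∪ ⁅ v ⁆) → NonNeighbour i
    non-face⇒nonNeighbour ¬face i∈N[v] =
      ¬face (clique⇒Ind {G = G} (Clique-⊆N[v] pair⊆N[v]) λ _ _ → tt)
      where
      pair⊆N[v] : ∀ {j} → j ∈ ⁅ i ⁆ ∪ ⁅ v ⁆ → ClosedNbhd G v j
      pair⊆N[v] j∈ with x∈⁅y⁆∪⁅z⁆⇒ j∈
      ... | inj₁ refl = i∈N[v]
      ... | inj₂ refl = inj₁ refl
    nonNeighbour⇒non-face : NonNeighbour i → ¬ Ind 2 G Everything (⁅ i ⁆ ∪ ⁅ v ⁆)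
    nonNeighbour⇒non-face i∉N[v] (_ , small) =
      <⇒≱ (small _ ⊆-refl independent)
        (subst (_< ∣ ⁅ i ⁆ ∪ ⁅ v ⁆ ∣) (∣⁅x⁆∣≡1 i) (x∉p⇒∣p∣<∣p∪⁅x⁆∣ (x≢y⇒x∉⁅y⁆ (i≢v ∘ sym))))
      where
      independent : Independent G (⁅ i ⁆ ∪ ⁅ v ⁆)
      independent = Independent-∪⁅x⁆ {G = G} (Independent-⁅x⁆ {G = G} i) v-isolated
        where
        v-isolated : ∀ {j} → j ∈ ⁅ i ⁆ → ¬ Adj G v j
        v-isolated j∈⁅i⁆ rewrite x∈⁅y⁆⇒x≡y i j∈⁅i⁆ = i∉N[v] ∘ inj₂
  nonNeighbour? (suc k) _ K-col i =
    map′ (λ K⁅i⁆ → proj₁ K⁅i⁆ i (x∈⁅x⁆ i))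
         (λ i∉N[v] → clique⇒Ind {G = G} (Clique-⁅x⁆ {G = G} i)
                       λ j j∈ → subst NonNeighbour (sym (x∈⁅y⁆⇒x≡y i j∈)) i∉N[v])
         (collapsible⇒decidable (Ind-downClosed {G = G}) K-col ⁅ i ⁆)

  module Decomposition (k : ℕ) {M : Subset m} (∈M⇔ : ∀ {i} → i ∈ M ⇔ NonNeighbour i) where

    v∉M : v ∉ M
    v∉M v∈M = Equivalence.to ∈M⇔ v∈M (inj₁ refl)

    open Gluing v∉M (Ind (2 + k) G (λ i → i ≢ v)) (λ (η⊆V∖v , _) v∈η → η⊆V∖v v v∈η refl) public

    link-supported : SupportedOn M (Ind (suc k) G NonNeighbour)
    link-supported (η⊆ , _) i∈η = Equivalence.from ∈M⇔ (η⊆ _ i∈η)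

    face-through-v⇒link : ∀ {η} → v ∈ η → Ind (2 + k) G Everything η →
                          Ind (suc k) G NonNeighbour (η ∩ M)
    face-through-v⇒link {η} v∈η (_ , small) =
      (λ i i∈η∩M → Equivalence.to ∈M⇔ (proj₂ (x∈p∩q⁻ η M i∈η∩M))) ,
      λ S S⊆η∩M independent → ≤-pred (≤-trans (s≤s (x∉p⇒∣p∣<∣p∪⁅x⁆∣ (v∉M ∘ S⊆M S⊆η∩M)))
                                (small (S ∪ ⁅ v ⁆) (S⁺⊆η S⊆η∩M) (S⁺-independent S⊆η∩M independent)))
      where
      S⊆M : ∀ {S} → S ⊆ η ∩ M → S ⊆ M
      S⊆M S⊆η∩M = p∩q⊆q η M ∘ S⊆η∩M
      S⁺⊆η : ∀ {S} → S ⊆ η ∩ M → S ∪ ⁅ v ⁆ ⊆ η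
      S⁺⊆η S⊆η∩M = Equivalence.from (p∪⁅x⁆⊆q⇔p⊆q∩r (S⊆M S⊆η∩M) v∈η) S⊆η∩M
      S⁺-independent : ∀ {S} → S ⊆ η ∩ M → Independent G S → Independent G (S ∪ ⁅ v ⁆)
      S⁺-independent S⊆η∩M independent = Independent-∪⁅x⁆ {G = G} independent
        λ i∈S v~i → Equivalence.to ∈M⇔ (S⊆M S⊆η∩M i∈S) (inj₂ v~i)

    link⇒face : ∀ {η} → Ind (suc k) G NonNeighbour (η ∩ M) → Ind (2 + k) G Everything η
    link⇒face {η} (_ , small) = (λ _ _ → tt) , λ S S⊆η independent →
      s≤s (≤-trans (p⊆q⇒∣p∣≤∣q∣ (p⊆[p∩q]∪[p∩∁q] S M))
          (≤-trans (∣p∪q∣≤∣p∣+∣q∣ (S ∩ M) (S ∩ ∁ M))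
          (≤-trans (+-mono-≤ (∣S∩M∣≤k S⊆η independent) (∣S∩∁M∣≤1 independent))
                   (≤-reflexive (+-comm k 1)))))
      where
      ∣S∩M∣≤k : ∀ {S} → S ⊆ η → Independent G S → ∣ S ∩ M ∣ ≤ k
      ∣S∩M∣≤k {S} S⊆η independent = ≤-pred (small (S ∩ M)
        (λ i∈ → let (i∈S , i∈M) = x∈p∩q⁻ S M i∈ in x∈p∩q⁺ (S⊆η i∈S , i∈M))
        (Independent-⊆ {G = G} (p∩q⊆p S M) independent))
      ∣S∩∁M∣≤1 : ∀ {S} → Independent G S → ∣ S ∩ ∁ M ∣ ≤ 1
      ∣S∩∁M∣≤1 {S} independent =
        independent∧¬¬clique⇒∣S∣≤1 {G = G} (Independent-⊆ {G = G} (p∩q⊆p S (∁ M)) independent)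
          λ i∈ j∈ i≢j ¬adj → in-N[v] i∈ λ i∈N[v] → in-N[v] j∈ λ j∈N[v] →
            ¬adj (simplicial _ _ i∈N[v] j∈N[v] i≢j)
        where
        in-N[v] : ∀ {i} → i ∈ S ∩ ∁ M → ¬ NonNeighbour i
        in-N[v] i∈ i∉N[v] = x∈∁p⇒x∉p (proj₂ (x∈p∩q⁻ S (∁ M) i∈)) (Equivalence.from ∈M⇔ i∉N[v])

    Glue≐Ind : Glue (Ind (suc k) G NonNeighbour) ≐ Ind (2 + k) G Everything
    Glue≐Ind = from , to
      where
      to : ∀ {η} → Ind (2 + k) G Everything η → Glue (Ind (suc k) G NonNeighbour) η
      to {η} face with v ∈? η
      ... | yes v∈η = inj₂ (v∈η , face-through-v⇒link v∈η face)
      ... | no v∉η = inj₁ ((λ i i∈η i≡v → v∉η (subst (_∈ η) i≡v i∈η)) , proj₂ face)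
      from : ∀ {η} → Glue (Ind (suc k) G NonNeighbour) η → Ind (2 + k) G Everything η
      from (inj₁ (_ , small)) = (λ _ _ → tt) , small
      from (inj₂ (_ , link)) = link⇒face link

lemma4p1 : ∀ {m} (G : Graph m) (v : Fin m) → Simplicial G v →
    ∀ (n : ℕ) → 2 ≤ n → ∀ (c c₁ c₂ : ℕ) →
    IsCollapsibility (Ind n G Everything) c →
    IsCollapsibility (Ind n G (λ i → i ≢ v)) c₁ →
    IsCollapsibility (Ind (n ∸ 1) G (λ i → ¬ ClosedNbhd G v i)) c₂ →
    c ≤ c₁ ⊔ suc c₂
lemma4p1 G v simplicial (suc (suc k)) (s≤s (s≤s z≤n)) c c₁ c₂
         (X-col , X-minimal) (D-col , _) (K-col , _) =
  X-minimal (c₁ ⊔ suc c₂) (Collapsible-resp-≐ Glue≐Ind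
    (glue-collapsible (m≤n⊔m c₁ (suc c₂)) (Collapsible-mono (m≤m⊔n c₁ (suc c₂)) D-col)
                      link-supported K-col))
  where
  open SimplicialVertex {G = G} simplicial
  open Decomposition k (x∈toSubset⇔ {P = NonNeighbour} (nonNeighbour? k X-col K-col))
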